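{- Let $G$ be a finite simple graph with minimum degree at least $1$, and let $u$ and $v$ be non-adjacent vertices of $G$ such that $d(u)\ge \max_{u'\in N(u)} d(u')$ and $d(v)\ge \max_{v'\in N(v)} d(v')$. Then $\mathcal{HSO}(G+uv)>\mathcal{HSO}(G)$.
   Context: For a vertex $w$ of a graph $G$, $d(w)=d_G(w)$ is its degree and $N(w)$ is the set of vertices adjacent to $w$. The hyperbolic Sombor index of a graph $G$ with edge set $E(G)$ is $\mathcal{HSO}(G)=\sum_{xy\in E(G)} \frac{\sqrt{d(x)^2+d(y)^2}}{\min\{d(x),d(y)\}}$. For non-adjacent vertices $u,v$ of $G$, $G+uv$ denotes the graph obtained from $G$ by adding the edge $uv$. -}

module Defs where

open import Data.Bool using (Bool; true; false; if_then_else_; _∧_; _∨_)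
open import Data.Nat using (ℕ; _<ᵇ_; _⊓_)
import Data.Nat as ℕ
open import Data.Fin using (Fin; toℕ; _≟_)
open import Data.List using (List; []; _∷_; map; allFin; concatMap)
open import Data.Nat.ListAction using (sum)
open import Data.Integer using (+_)
open import Data.Rational using (ℚ; _/_; 0ℚ; _<_; _≤_; _+_; _*_)
open import Data.Product using (_×_; _,_; Σ; ∃)
open import Data.Sum using (_⊎_)
open import Relation.Nullary.Decidable using (⌊_⌋)
open import Relation.Binary.PropositionalEquality using (_≡_)
open import Level using (0ℓ; suc)

Graph : ℕ → Set
Graph n = Fin n → Fin n → Bool

IsSimple : ∀ {n} → Graph n → Set
IsSimple {n} G = (∀ (x y : Fin n) → G x y ≡ G y x) × (∀ (x : Fin n) → G x x ≡ false)

deg : ∀ {n} → Graph n → Fin n → ℕ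
deg {n} G x = sum (map (λ y → if G x y then 1 else 0) (allFin n))

edges : ∀ {n} → Graph n → List (Fin n × Fin n)
edges {n} G =
  concatMap (λ x → concatMap (λ y → if G x y ∧ (toℕ x <ᵇ toℕ y) then (x , y) ∷ [] else [])
                             (allFin n))
            (allFin n)

addEdge : ∀ {n} → Graph n → Fin n → Fin n → Graph n
addEdge G u v x y = G x y ∨ ((⌊ x ≟ u ⌋ ∧ ⌊ y ≟ v ⌋) ∨ (⌊ x ≟ v ⌋ ∧ ⌊ y ≟ u ⌋))

-- Real numbers as (two-sided) Dedekind cuts over ℚ: a real r is given
-- by its lower cut L (q < r) and upper cut U (r < q).

record Cut : Set₁ where
  field
    L : ℚ → Set
    U : ℚ → Set
open Cut public

fromℕ : ℕ → ℚ
fromℕ k = + k / 1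

-- the real number √A / m  (A, m natural, m ≥ 1 in all uses):
--   q < √A/m  ⟺  q*m < 0 or (q*m)² < A
--   √A/m < q  ⟺  0 < q*m and A < (q*m)²
sqrtDiv : ℕ → ℕ → Cut
L (sqrtDiv A m) q = (q * fromℕ m < 0ℚ) ⊎ ((q * fromℕ m) * (q * fromℕ m) < fromℕ A)
U (sqrtDiv A m) q = (0ℚ < q * fromℕ m) × (fromℕ A < (q * fromℕ m) * (q * fromℕ m))

zeroCut : Cut
L zeroCut q = q < 0ℚ
U zeroCut q = 0ℚ < q

_+ᶜ_ : Cut → Cut → Cut
L (x +ᶜ y) q = Σ ℚ λ a → Σ ℚ λ b → L x a × L y b × (q ≤ a + b)
U (x +ᶜ y) q = Σ ℚ λ a → Σ ℚ λ b → U x a × U y b × (a + b ≤ q)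

sumCut : List Cut → Cut
sumCut []       = zeroCut
sumCut (c ∷ cs) = c +ᶜ sumCut cs

_<ᶜ_ : Cut → Cut → Set
x <ᶜ y = Σ ℚ λ q → U x q × L y q

hsoTerm : ∀ {n} → Graph n → Fin n × Fin n → Cut
hsoTerm G (x , y) =
  sqrtDiv (deg G x ℕ.* deg G x ℕ.+ deg G y ℕ.* deg G y) (deg G x ⊓ deg G y)

HSO : ∀ {n} → Graph n → Cut
HSO G = sumCut (map (hsoTerm G) (edges G))

-- For an edge xy of G, the minimum of the end degrees is the same in G and in G + uv: if x is u
-- (or v), then y is neither u nor v, so d(y) does not change, and d(y) ≤ d(x) ≤ d'(x) by the
-- maximality of d(u) (or d(v)) among its neighbours. The numerators √(d(x)² + d(y)²) can only
-- grow, so every old term of the index weakly increases, and the new term for uv exceeds 1.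
-- To separate the two sums by a rational, each old term is bracketed between grid points of
-- mesh 1/(k+1); with k = 2|E(G)| + 1 the accumulated bracket width is 1, which the new term
-- absorbs.
module Submission where

open import Defs
open import Data.Nat using (ℕ; _≤_)
open import Data.Fin using (Fin)
open import Data.Bool using (Bool; true; false)
open import Relation.Binary.PropositionalEquality using (_≡_; _≢_)

open import Data.Bool using (T; not; _∧_; _∨_; if_then_else_)
open import Data.Bool.Properties using (∨-zeroʳ; ∨-identityʳ)
open import Data.Bool.ListAction using (any)
open import Data.Nat as ℕ using (zero; suc; _⊓_; _<ᵇ_; z≤n)
import Data.Nat.Properties as ℕP
open import Data.Nat.Coprimality as Coprime using (1-coprimeTo)
open import Data.Nat.ListAction using (sum)
open import Data.Fin using (toℕ; _≟_)
import Data.Fin.Properties as FinP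
open import Data.Integer as ℤ using (+_; +[1+_])
import Data.Integer.Properties as ℤP
open import Data.Rational as ℚ using (ℚ; mkℚ; 0ℚ; 1ℚ; -_; _+_; _*_; _<_; *<*; *≤*; Positive)
  renaming (_≤_ to _≤ℚ_)
import Data.Rational.Properties as ℚP
open import Data.Rational.Solver using (module +-*-Solver)
open import Data.List using (List; []; _∷_; _++_; map; length; concatMap; allFin)
import Data.List.Properties as ListP
open import Data.List.Membership.Propositional using (lose)
open import Data.List.Membership.Propositional.Properties using (∈-allFin)
open import Data.List.Relation.Unary.All using (All; []; _∷_; universal)
open import Data.List.Relation.Unary.All.Properties using (map⁺)
open import Data.List.Relation.Unary.Any.Properties using (any⁺)
open import Data.Product using (Σ; ∃; _×_; _,_; proj₁; proj₂)
open import Data.Sum using (_⊎_; inj₁; inj₂)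
open import Data.Empty using (⊥-elim)
open import Function using (_∘_)
open import Relation.Nullary using (¬_; Dec; yes; no; contradiction)
open import Relation.Nullary.Decidable using (⌊_⌋; isYes≗does; dec-true; dec-false; _⊎-dec_)
open import Relation.Unary using (Decidable)
open import Relation.Binary.Definitions using (tri<; tri≈; tri>)
open import Relation.Binary.PropositionalEquality
  using (refl; sym; trans; cong; cong₂; subst; subst₂; module ≡-Reasoning)
open +-*-Solver

fromℕ≡mkℚ : ∀ k → fromℕ k ≡ mkℚ (+ k) 0 (Coprime.sym (1-coprimeTo k))
fromℕ≡mkℚ k = ℚP.normalize-coprime (Coprime.sym (1-coprimeTo k))

fromℕ-mono-< : ∀ {a b} → a ℕ.< b → fromℕ a < fromℕ b
fromℕ-mono-< {a} {b} a<b rewrite fromℕ≡mkℚ a | fromℕ≡mkℚ b =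
  *<* (subst₂ ℤ._<_ (sym (ℤP.*-identityʳ (+ a))) (sym (ℤP.*-identityʳ (+ b))) (ℤ.+<+ a<b))

fromℕ-mono-≤ : ∀ {a b} → a ≤ b → fromℕ a ≤ℚ fromℕ b
fromℕ-mono-≤ {a} {b} a≤b rewrite fromℕ≡mkℚ a | fromℕ≡mkℚ b =
  *≤* (subst₂ ℤ._≤_ (sym (ℤP.*-identityʳ (+ a))) (sym (ℤP.*-identityʳ (+ b))) (ℤ.+≤+ a≤b))

fromℕ-homo-* : ∀ a b → fromℕ (a ℕ.* b) ≡ fromℕ a * fromℕ b
fromℕ-homo-* a b rewrite fromℕ≡mkℚ a | fromℕ≡mkℚ b = cong (ℚ._/ 1) (ℤP.pos-* a b)

fromℕ-homo-+ : ∀ a b → fromℕ (a ℕ.+ b) ≡ fromℕ a + fromℕ b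
fromℕ-homo-+ a b rewrite fromℕ≡mkℚ a | fromℕ≡mkℚ b =
  cong (ℚ._/ 1) (trans (ℤP.pos-+ a b) (sym (cong₂ ℤ._+_ (ℤP.*-identityʳ (+ a)) (ℤP.*-identityʳ (+ b)))))

1/[1+_] : ℕ → ℚ
1/[1+ k ] = mkℚ (+ 1) k (1-coprimeTo (suc k))

fromℕ[1+k]*1/[1+k]≡1 : ∀ k → fromℕ (suc k) * 1/[1+ k ] ≡ 1ℚ
fromℕ[1+k]*1/[1+k]≡1 k rewrite fromℕ≡mkℚ (suc k) =
  ℚP.*-inverseʳ (mkℚ +[1+ k ] 0 (Coprime.sym (1-coprimeTo (suc k))))

1/[1+k]>0 : ∀ k → 0ℚ < 1/[1+ k ]
1/[1+k]>0 k = ℚP.positive⁻¹ 1/[1+ k ]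

_⊆ᴸ_ : Cut → Cut → Set
x ⊆ᴸ y = ∀ q → L x q → L y q

Bracket : ℚ → Cut → Set
Bracket ε x = Σ ℚ λ p → Σ ℚ λ q → U x p × L x q × p ≤ℚ q + ε

tolerance : ℕ → ℚ
tolerance k = 1/[1+ k ] + 1/[1+ k ]

Bracketable : Cut → Set
Bracketable x = ∀ k → Bracket (tolerance k) x

zeroCut-bracket : ∀ k → Bracket (tolerance k) zeroCut
zeroCut-bracket k = h , - h , 1/[1+k]>0 k , ℚP.neg-antimono-< (1/[1+k]>0 k) ,
  ℚP.≤-reflexive (solve 1 (λ h → h := (:- h) :+ (h :+ h)) refl h)
  where
  h : ℚ
  h = 1/[1+ k ]

+ᶜ-bracket : ∀ {ε δ x y} → Bracket ε x → Bracket δ y → Bracket (ε + δ) (x +ᶜ y)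
+ᶜ-bracket {ε} {δ} (p , q , Up , Lq , p≤q+ε) (p' , q' , Up' , Lq' , p'≤q'+δ) =
  p + p' , q + q' , (p , p' , Up , Up' , ℚP.≤-refl) , (q , q' , Lq , Lq' , ℚP.≤-refl) ,
  ℚP.≤-trans (ℚP.+-mono-≤ p≤q+ε p'≤q'+δ) (ℚP.≤-reflexive regroup)
  where
  regroup : (q + ε) + (q' + δ) ≡ (q + q') + (ε + δ)
  regroup = solve 4 (λ q q' ε δ → (q :+ ε) :+ (q' :+ δ) := (q :+ q') :+ (ε :+ δ)) refl q q' ε δ

sumCut-bracket : ∀ {cs} → All Bracketable cs → ∀ k →
  Bracket (fromℕ (suc (length cs)) * tolerance k) (sumCut cs)
sumCut-bracket [] k =
  subst (λ ε → Bracket ε zeroCut) (sym (ℚP.*-identityˡ (tolerance k))) (zeroCut-bracket k)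
sumCut-bracket {c ∷ cs} (bc ∷ bcs) k =
  subst (λ ε → Bracket ε (sumCut (c ∷ cs))) count (+ᶜ-bracket (bc k) (sumCut-bracket bcs k))
  where
  n : ℕ
  n = suc (length cs)
  count : tolerance k + fromℕ n * tolerance k ≡ fromℕ (suc n) * tolerance k
  count = trans (solve 2 (λ t x → t :+ x :* t := (con 1ℚ :+ x) :* t) refl (tolerance k) (fromℕ n))
                (cong (_* tolerance k) (sym (fromℕ-homo-+ 1 n)))

tolerance-total : ∀ n → fromℕ (suc n) * tolerance (n ℕ.+ suc n) ≡ 1ℚ
tolerance-total n = begin
  fromℕ (suc n) * (h + h)             ≡⟨ solve 2 (λ x h → x :* (h :+ h) := (x :+ x) :* h) refl (fromℕ (suc n)) h ⟩
  (fromℕ (suc n) + fromℕ (suc n)) * h ≡⟨ cong (_* h) (sym (fromℕ-homo-+ (suc n) (suc n))) ⟩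
  fromℕ (suc n ℕ.+ suc n) * h         ≡⟨ fromℕ[1+k]*1/[1+k]≡1 (n ℕ.+ suc n) ⟩
  1ℚ                                  ∎
  where
  open ≡-Reasoning
  h : ℚ
  h = 1/[1+ n ℕ.+ suc n ]

sumCut-L-down : ∀ cs {a c} → a ≤ℚ c → L (sumCut cs) c → L (sumCut cs) a
sumCut-L-down []      a≤c c<0                      = ℚP.≤-<-trans a≤c c<0
sumCut-L-down (_ ∷ _) a≤c (p , q , Lp , Lq , c≤p+q) = p , q , Lp , Lq , ℚP.≤-trans a≤c c≤p+q

sqrtDiv-monoˡ : ∀ {A A' m} → A ≤ A' → sqrtDiv A m ⊆ᴸ sqrtDiv A' m
sqrtDiv-monoˡ A≤A' q (inj₁ qm<0)  = inj₁ qm<0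
sqrtDiv-monoˡ A≤A' q (inj₂ qm²<A) = inj₂ (ℚP.<-≤-trans qm²<A (fromℕ-mono-≤ A≤A'))

sqrtDiv>1 : ∀ {A m} → m ℕ.* m ℕ.< A → L (sqrtDiv A m) 1ℚ
sqrtDiv>1 {A} {m} m²<A = inj₂ (subst (_< fromℕ A) m²≡[1*m]² (fromℕ-mono-< m²<A))
  where
  m²≡[1*m]² : fromℕ (m ℕ.* m) ≡ (1ℚ * fromℕ m) * (1ℚ * fromℕ m)
  m²≡[1*m]² = trans (fromℕ-homo-* m m) (cong (λ x → x * x) (sym (ℚP.*-identityˡ (fromℕ m))))

module _ (k : ℕ) where
  private
    h : ℚ
    h = 1/[1+ k ]
    K : ℕ
    K = suc k
    instance
      h²-pos : Positive (h * h)
      h²-pos = ℚP.pos*pos⇒pos h h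

    fromℕ-rescale : ∀ N → fromℕ (N ℕ.* K ℕ.* K) * (h * h) ≡ fromℕ N
    fromℕ-rescale N = begin
      fromℕ (N ℕ.* K ℕ.* K) * (h * h)
        ≡⟨ cong (_* (h * h)) (trans (fromℕ-homo-* (N ℕ.* K) K) (cong (_* fromℕ K) (fromℕ-homo-* N K))) ⟩
      fromℕ N * fromℕ K * fromℕ K * (h * h)
        ≡⟨ solve 3 (λ n k h → n :* k :* k :* (h :* h) := n :* ((k :* h) :* (k :* h))) refl (fromℕ N) (fromℕ K) h ⟩
      fromℕ N * ((fromℕ K * h) * (fromℕ K * h))
        ≡⟨ cong (λ x → fromℕ N * (x * x)) (fromℕ[1+k]*1/[1+k]≡1 k) ⟩
      fromℕ N * 1ℚ
        ≡⟨ ℚP.*-identityʳ (fromℕ N) ⟩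
      fromℕ N ∎
      where open ≡-Reasoning

    grid-sq : ∀ s m → fromℕ ((s ℕ.* m) ℕ.* (s ℕ.* m)) * (h * h)
                      ≡ (fromℕ s * h * fromℕ m) * (fromℕ s * h * fromℕ m)
    grid-sq s m = begin
      fromℕ ((s ℕ.* m) ℕ.* (s ℕ.* m)) * (h * h)
        ≡⟨ cong (_* (h * h)) (trans (fromℕ-homo-* (s ℕ.* m) (s ℕ.* m)) (cong₂ _*_ (fromℕ-homo-* s m) (fromℕ-homo-* s m))) ⟩
      (fromℕ s * fromℕ m) * (fromℕ s * fromℕ m) * (h * h)
        ≡⟨ solve 3 (λ s m h → (s :* m) :* (s :* m) :* (h :* h) := (s :* h :* m) :* (s :* h :* m)) refl (fromℕ s) (fromℕ m) h ⟩
      (fromℕ s * h * fromℕ m) * (fromℕ s * h * fromℕ m) ∎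
      where open ≡-Reasoning

  sqrtDiv-L-grid : ∀ {A m s} → (s ℕ.* m) ℕ.* (s ℕ.* m) ℕ.< A ℕ.* suc k ℕ.* suc k →
    L (sqrtDiv A m) (fromℕ s * 1/[1+ k ])
  sqrtDiv-L-grid {A} {m} {s} lt =
    inj₂ (subst₂ _<_ (grid-sq s m) (fromℕ-rescale A) (ℚP.*-monoˡ-<-pos (h * h) (fromℕ-mono-< lt)))

  sqrtDiv-U-grid : ∀ {A m s} → 0 ℕ.< s ℕ.* m → A ℕ.* suc k ℕ.* suc k ℕ.< (s ℕ.* m) ℕ.* (s ℕ.* m) →
    U (sqrtDiv A m) (fromℕ s * 1/[1+ k ])
  sqrtDiv-U-grid {A} {m} {s} 0<sm lt =
    subst₂ _<_ (ℚP.*-zeroˡ h) reassoc (ℚP.*-monoˡ-<-pos h (fromℕ-mono-< 0<sm)) ,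
    subst₂ _<_ (fromℕ-rescale A) (grid-sq s m) (ℚP.*-monoˡ-<-pos (h * h) (fromℕ-mono-< lt))
    where
    reassoc : fromℕ (s ℕ.* m) * h ≡ fromℕ s * h * fromℕ m
    reassoc = trans (cong (_* h) (fromℕ-homo-* s m))
                    (solve 3 (λ s m h → s :* m :* h := s :* h :* m) refl (fromℕ s) (fromℕ m) h)

  -- Only A(k+1)² ≤ ((s+1)m)² is assumed, so the strict upper bound is taken at grid point s+2.
  sqrtDiv-bracket-at : ∀ {A m} s → 1 ≤ m →
    (s ℕ.* m) ℕ.* (s ℕ.* m) ℕ.< A ℕ.* suc k ℕ.* suc k →
    A ℕ.* suc k ℕ.* suc k ≤ (suc s ℕ.* m) ℕ.* (suc s ℕ.* m) →
    Bracket (tolerance k) (sqrtDiv A m)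
  sqrtDiv-bracket-at {A} {m@(suc _)} s _ below above =
    fromℕ (2 ℕ.+ s) * h , fromℕ s * h ,
    sqrtDiv-U-grid {A} {m} {2 ℕ.+ s} ℕ.z<s (ℕP.≤-<-trans above (ℕP.*-mono-< [1+s]m<[2+s]m [1+s]m<[2+s]m)) ,
    sqrtDiv-L-grid {A} {m} {s} below ,
    ℚP.≤-reflexive two-steps
    where
    [1+s]m<[2+s]m : suc s ℕ.* m ℕ.< suc (suc s) ℕ.* m
    [1+s]m<[2+s]m = ℕP.*-monoˡ-< m (ℕP.n<1+n (suc s))
    two-steps : fromℕ (2 ℕ.+ s) * h ≡ fromℕ s * h + tolerance k
    two-steps = trans (cong (_* h) (fromℕ-homo-+ 2 s))
      (solve 2 (λ s h → (con 1ℚ :+ con 1ℚ :+ s) :* h := s :* h :+ (h :+ h)) refl (fromℕ s) h)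

crossing : ∀ {P : ℕ → Set} → Decidable P → ∀ {N} → P 0 → ¬ P N → ∃ λ s → P s × ¬ P (suc s)
crossing P? {zero}  P0 ¬PN = ⊥-elim (¬PN P0)
crossing P? {suc N} P0 ¬PN with P? N
... | yes PN  = N , PN , ¬PN
... | no ¬PN' = crossing P? P0 ¬PN'

sqrtDiv-bracketable : ∀ {A m} → 1 ≤ A → 1 ≤ m → Bracketable (sqrtDiv A m)
sqrtDiv-bracketable {A@(suc _)} {m@(suc _)} _ 1≤m k =
  let s , below , ¬below = crossing (λ s → (s ℕ.* m) ℕ.* (s ℕ.* m) ℕ.<? X) {X} ℕ.z<s ¬below-X
  in sqrtDiv-bracket-at k {A} {m} s 1≤m below (ℕP.≮⇒≥ ¬below)
  where
  X : ℕ
  X = A ℕ.* suc k ℕ.* suc k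
  ¬below-X : ¬ (X ℕ.* m) ℕ.* (X ℕ.* m) ℕ.< X
  ¬below-X = ℕP.≤⇒≯ (ℕP.≤-trans (ℕP.m≤m*n X m) (ℕP.m≤m*n (X ℕ.* m) (X ℕ.* m)))

𝟙 : Bool → ℚ
𝟙 b = if b then 1ℚ else 0ℚ

q≤q+𝟙 : ∀ q b → q ≤ℚ q + 𝟙 b
q≤q+𝟙 q true  = subst (_≤ℚ q + 1ℚ) (ℚP.+-identityʳ q) (ℚP.+-monoʳ-≤ q (ℚP.<⇒≤ (ℚP.positive⁻¹ 1ℚ)))
q≤q+𝟙 q false = ℚP.≤-reflexive (sym (ℚP.+-identityʳ q))

module _ {P : Set} (F G : P → Cut) where

  data Raise : Bool → List P → List P → Set where
    nil    : Raise false [] []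
    keep   : ∀ {b x xs ys} → F x ⊆ᴸ G x → Raise b xs ys → Raise b (x ∷ xs) (x ∷ ys)
    insert : ∀ {b y xs ys} → L (G y) 1ℚ → Raise b xs ys → Raise true xs (y ∷ ys)

  Raise-L : ∀ {b xs ys q} → Raise b xs ys →
    L (sumCut (map F xs)) q → L (sumCut (map G ys)) (q + 𝟙 b)
  Raise-L {q = q} nil q<0 = subst (_< 0ℚ) (sym (ℚP.+-identityʳ q)) q<0
  Raise-L {b} {q = q} (keep F⊆G r) (a , c , La , Lc , q≤a+c) =
    a , c + 𝟙 b , F⊆G a La , Raise-L r Lc ,
    ℚP.≤-trans (ℚP.+-monoˡ-≤ (𝟙 b) q≤a+c) (ℚP.≤-reflexive (ℚP.+-assoc a c (𝟙 b)))
  Raise-L {q = q} (insert {b = b} {ys = ys} G>1 r) Lq =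
    1ℚ , q , G>1 , sumCut-L-down (map G ys) (q≤q+𝟙 q b) (Raise-L r Lq) ,
    ℚP.≤-reflexive (ℚP.+-comm q 1ℚ)

  Raise-<ᶜ : ∀ {b xs ys} → (∀ x → Bracketable (F x)) → Raise b xs ys → T b →
    sumCut (map F xs) <ᶜ sumCut (map G ys)
  Raise-<ᶜ {true} {xs} {ys} bracketable r _ =
    let p , q , Up , Lq , p≤q+tol = sumCut-bracket (map⁺ (universal bracketable xs)) (n ℕ.+ suc n)
        p≤q+1 = subst (λ t → p ≤ℚ q + t) (tolerance-total n) p≤q+tol
    in p , Up , sumCut-L-down (map G ys) p≤q+1 (Raise-L r Lq)
    where
    n : ℕ
    n = length (map F xs)

  _++ᴿ_ : ∀ {b c xs ys xs' ys'} → Raise b xs ys → Raise c xs' ys' → Raise (b ∨ c) (xs ++ xs') (ys ++ ys')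
  nil          ++ᴿ r' = r'
  keep F⊆G r   ++ᴿ r' = keep F⊆G (r ++ᴿ r')
  insert G>1 r ++ᴿ r' = insert G>1 (r ++ᴿ r')

  Raise-concatMap : ∀ {A : Set} {f g : A → List P} {β : A → Bool} →
    (∀ a → Raise (β a) (f a) (g a)) → ∀ l → Raise (any β l) (concatMap f l) (concatMap g l)
  Raise-concatMap r []      = nil
  Raise-concatMap r (a ∷ l) = r a ++ᴿ Raise-concatMap r l

  Raise-if : ∀ z g h c → (g ≡ true → h ≡ true) → (g ≡ true → F z ⊆ᴸ G z) → L (G z) 1ℚ →
    Raise (not g ∧ h ∧ c) (if g ∧ c then z ∷ [] else []) (if h ∧ c then z ∷ [] else [])
  Raise-if z true  true  true  _   F⊆G _   = keep (F⊆G refl) nil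
  Raise-if z true  true  false _   _   _   = nil
  Raise-if z true  false _     g⇒h _   _   with () ← g⇒h refl
  Raise-if z false true  true  _   _   G>1 = insert G>1 nil
  Raise-if z false true  false _   _   _   = nil
  Raise-if z false false _     _   _   _   = nil

sum-map-mono : ∀ {A : Set} {f g : A → ℕ} → (∀ a → f a ≤ g a) → ∀ l → sum (map f l) ≤ sum (map g l)
sum-map-mono f≤g []      = z≤n
sum-map-mono f≤g (a ∷ l) = ℕP.+-mono-≤ (f≤g a) (sum-map-mono f≤g l)

deg-mono : ∀ {n} {G H : Graph n} x → (∀ y → G x y ≡ true → H x y ≡ true) → deg G x ≤ deg H x
deg-mono {n} {G} {H} x G⇒H = sum-map-mono (λ y → indicator-mono (G⇒H y)) (allFin n)
  where
  indicator-mono : ∀ {g h : Bool} → (g ≡ true → h ≡ true) → (if g then 1 else 0) ≤ (if h then 1 else 0)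
  indicator-mono {true}  g⇒h rewrite g⇒h refl = ℕP.≤-refl
  indicator-mono {false} _   = z≤n

deg-cong : ∀ {n} {G H : Graph n} x → (∀ y → G x y ≡ H x y) → deg G x ≡ deg H x
deg-cong {n} x G≡H = cong sum (ListP.map-cong (λ y → cong (λ b → if b then 1 else 0) (G≡H y)) (allFin n))

hsoTerm-bracketable : ∀ {n} (G : Graph n) → (∀ x → 1 ≤ deg G x) → ∀ e → Bracketable (hsoTerm G e)
hsoTerm-bracketable G deg≥1 (x , y) =
  sqrtDiv-bracketable (ℕP.≤-trans (ℕP.*-mono-≤ (deg≥1 x) (deg≥1 x)) (ℕP.m≤m+n _ _))
                      (ℕP.⊓-glb (deg≥1 x) (deg≥1 y))

hsoTerm>1 : ∀ {n} (G : Graph n) → (∀ x → 1 ≤ deg G x) → ∀ e → L (hsoTerm G e) 1ℚ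
hsoTerm>1 G deg≥1 (x , y) =
  sqrtDiv>1 {a ℕ.* a ℕ.+ b ℕ.* b} {a ⊓ b}
    (ℕP.≤-<-trans (ℕP.*-mono-≤ min≤a min≤a) (ℕP.m<m+n (a ℕ.* a) (ℕP.*-mono-≤ (deg≥1 y) (deg≥1 y))))
  where
  a b : ℕ
  a = deg G x
  b = deg G y
  min≤a : a ⊓ b ≤ a
  min≤a = ℕP.m⊓n≤m a b

hsoTerm-mono : ∀ {n} {G H : Graph n} {x y} → deg G x ≤ deg H x → deg G y ≤ deg H y →
  deg G x ⊓ deg G y ≡ deg H x ⊓ deg H y → hsoTerm G (x , y) ⊆ᴸ hsoTerm H (x , y)
hsoTerm-mono {G = G} {H} {x} {y} dx dy min≡ =
  subst (λ m → hsoTerm G (x , y) ⊆ᴸ sqrtDiv (sumsq H) m) min≡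
        (sqrtDiv-monoˡ {sumsq G} {sumsq H} {deg G x ⊓ deg G y}
          (ℕP.+-mono-≤ (ℕP.*-mono-≤ dx dx) (ℕP.*-mono-≤ dy dy)))
  where
  sumsq : Graph _ → ℕ
  sumsq K = deg K x ℕ.* deg K x ℕ.+ deg K y ℕ.* deg K y

newEdge : ∀ {n} → Graph n → Graph n → Fin n → Fin n → Bool
newEdge G H x y = not (G x y) ∧ H x y ∧ (toℕ x <ᵇ toℕ y)

hasNewEdge : ∀ {n} → Graph n → Graph n → Bool
hasNewEdge {n} G H = any (λ x → any (newEdge G H x) (allFin n)) (allFin n)

hasNewEdge-intro : ∀ {n} (G H : Graph n) {x y} → G x y ≡ false → H x y ≡ true → toℕ x ℕ.< toℕ y →
  T (hasNewEdge G H)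
hasNewEdge-intro G H {x} {y} Gxy Hxy x<y =
  any⁺ _ (lose (∈-allFin x) (any⁺ _ (lose (∈-allFin y) new)))
  where
  new : T (newEdge G H x y)
  new rewrite Gxy | Hxy = ℕP.<⇒<ᵇ x<y

edges-Raise : ∀ {n} (G H : Graph n) {F F' : Fin n × Fin n → Cut} →
  (∀ x y → G x y ≡ true → H x y ≡ true) →
  (∀ x y → G x y ≡ true → F (x , y) ⊆ᴸ F' (x , y)) →
  (∀ e → L (F' e) 1ℚ) →
  Raise F F' (hasNewEdge G H) (edges G) (edges H)
edges-Raise {n} G H {F} {F'} G⊆H F⊆F' F'>1 =
  Raise-concatMap F F' (λ x → Raise-concatMap F F' (λ y →
    Raise-if F F' (x , y) (G x y) (H x y) (toℕ x <ᵇ toℕ y) (G⊆H x y) (F⊆F' x y) (F'>1 (x , y)))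
    (allFin n)) (allFin n)

⌊⌋-yes : ∀ {A : Set} (a? : Dec A) → A → ⌊ a? ⌋ ≡ true
⌊⌋-yes a? a = trans (isYes≗does a?) (dec-true a? a)

⌊⌋-no : ∀ {A : Set} (a? : Dec A) → ¬ A → ⌊ a? ⌋ ≡ false
⌊⌋-no a? ¬a = trans (isYes≗does a?) (dec-false a? ¬a)

module _ {n} (G : Graph n) (u v : Fin n) where

  addEdge-⊇ : ∀ x y → G x y ≡ true → addEdge G u v x y ≡ true
  addEdge-⊇ x y Gxy rewrite Gxy = refl

  addEdge-uv : addEdge G u v u v ≡ true
  addEdge-uv rewrite ⌊⌋-yes (u ≟ u) refl | ⌊⌋-yes (v ≟ v) refl = ∨-zeroʳ (G u v)

  addEdge-vu : addEdge G u v v u ≡ true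
  addEdge-vu rewrite ⌊⌋-yes (u ≟ u) refl | ⌊⌋-yes (v ≟ v) refl =
    trans (cong (G v u ∨_) (∨-zeroʳ _)) (∨-zeroʳ (G v u))

  addEdge-elsewhere : ∀ {x} → x ≢ u → x ≢ v → ∀ y → G x y ≡ addEdge G u v x y
  addEdge-elsewhere {x} x≢u x≢v y rewrite ⌊⌋-no (x ≟ u) x≢u | ⌊⌋-no (x ≟ v) x≢v =
    sym (∨-identityʳ (G x y))

  addEdge-hasNewEdge : IsSimple G → u ≢ v → G u v ≡ false → T (hasNewEdge G (addEdge G u v))
  addEdge-hasNewEdge (symmetric , _) u≢v Guv with FinP.<-cmp u v
  ... | tri< u<v _ _ = hasNewEdge-intro G (addEdge G u v) Guv addEdge-uv u<v
  ... | tri≈ _ u≡v _ = contradiction u≡v u≢v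
  ... | tri> _ _ v<u = hasNewEdge-intro G (addEdge G u v) (trans (symmetric v u) Guv) addEdge-vu v<u

module DegreeMaximalEndpoints {n} (G : Graph n) (u v : Fin n) (simple : IsSimple G) (Guv : G u v ≡ false)
         (u-max : ∀ u' → G u u' ≡ true → deg G u' ≤ deg G u)
         (v-max : ∀ v' → G v v' ≡ true → deg G v' ≤ deg G v) where

  H : Graph n
  H = addEdge G u v

  Endpoint : Fin n → Set
  Endpoint x = x ≡ u ⊎ x ≡ v

  deg-addEdge-mono : ∀ x → deg G x ≤ deg H x
  deg-addEdge-mono x = deg-mono {G = G} {H} x (addEdge-⊇ G u v x)

  deg-addEdge-elsewhere : ∀ {x} → ¬ Endpoint x → deg G x ≡ deg H x
  deg-addEdge-elsewhere x∉ = deg-cong {G = G} {H} _ (addEdge-elsewhere G u v (x∉ ∘ inj₁) (x∉ ∘ inj₂))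

  endpoint-neighbour : ∀ {x y} → G x y ≡ true → Endpoint x → ¬ Endpoint y × deg G y ≤ deg G x
  endpoint-neighbour {y = y} Gxy (inj₁ refl) = y∉ , u-max y Gxy
    where
    y∉ : ¬ Endpoint y
    y∉ (inj₁ refl) with () ← trans (sym Gxy) (proj₂ simple u)
    y∉ (inj₂ refl) with () ← trans (sym Gxy) Guv
  endpoint-neighbour {y = y} Gxy (inj₂ refl) = y∉ , v-max y Gxy
    where
    y∉ : ¬ Endpoint y
    y∉ (inj₁ refl) with () ← trans (sym Gxy) (trans (proj₁ simple v u) Guv)
    y∉ (inj₂ refl) with () ← trans (sym Gxy) (proj₂ simple v)

  ⊓-deg-addEdge-endpoint : ∀ {x y} → G x y ≡ true → Endpoint x →
    deg G x ⊓ deg G y ≡ deg H x ⊓ deg H y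
  ⊓-deg-addEdge-endpoint {x} {y} Gxy x∈ = begin
    deg G x ⊓ deg G y ≡⟨ ℕP.m≥n⇒m⊓n≡n dy≤dx ⟩
    deg G y           ≡⟨ ℕP.m≥n⇒m⊓n≡n (ℕP.≤-trans dy≤dx (deg-addEdge-mono x)) ⟨
    deg H x ⊓ deg G y ≡⟨ cong (deg H x ⊓_) (deg-addEdge-elsewhere y∉) ⟩
    deg H x ⊓ deg H y ∎
    where
    open ≡-Reasoning
    y∉ : ¬ Endpoint y
    y∉ = proj₁ (endpoint-neighbour Gxy x∈)
    dy≤dx : deg G y ≤ deg G x
    dy≤dx = proj₂ (endpoint-neighbour Gxy x∈)

  ⊓-deg-addEdge : ∀ {x y} → G x y ≡ true → deg G x ⊓ deg G y ≡ deg H x ⊓ deg H y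
  ⊓-deg-addEdge {x} {y} Gxy with x ≟ u ⊎-dec x ≟ v | y ≟ u ⊎-dec y ≟ v
  ... | yes x∈ | _      = ⊓-deg-addEdge-endpoint Gxy x∈
  ... | no _   | yes y∈ = begin
    deg G x ⊓ deg G y ≡⟨ ℕP.⊓-comm (deg G x) (deg G y) ⟩
    deg G y ⊓ deg G x ≡⟨ ⊓-deg-addEdge-endpoint (trans (proj₁ simple y x) Gxy) y∈ ⟩
    deg H y ⊓ deg H x ≡⟨ ℕP.⊓-comm (deg H y) (deg H x) ⟩
    deg H x ⊓ deg H y ∎
    where open ≡-Reasoning
  ... | no x∉  | no y∉  = cong₂ _⊓_ (deg-addEdge-elsewhere x∉) (deg-addEdge-elsewhere y∉)

  hsoTerm-addEdge-mono : ∀ x y → G x y ≡ true → hsoTerm G (x , y) ⊆ᴸ hsoTerm H (x , y)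
  hsoTerm-addEdge-mono x y Gxy =
    hsoTerm-mono {G = G} {H} (deg-addEdge-mono x) (deg-addEdge-mono y) (⊓-deg-addEdge Gxy)

proposition3 : ∀ {n : ℕ} (G : Graph n) (u v : Fin n)
    → IsSimple G
    → (∀ (x : Fin n) → 1 ≤ deg G x)
    → u ≢ v
    → G u v ≡ false
    → (∀ (u' : Fin n) → G u u' ≡ true → deg G u' ≤ deg G u)
    → (∀ (v' : Fin n) → G v v' ≡ true → deg G v' ≤ deg G v)
    → HSO G <ᶜ HSO (addEdge G u v)
proposition3 G u v simple deg≥1 u≢v Guv u-max v-max =
  Raise-<ᶜ (hsoTerm G) (hsoTerm H) (hsoTerm-bracketable G deg≥1)
    (edges-Raise G H (addEdge-⊇ G u v) hsoTerm-addEdge-mono (hsoTerm>1 H deg≥1ᴴ))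
    (addEdge-hasNewEdge G u v simple u≢v Guv)
  where
  open DegreeMaximalEndpoints G u v simple Guv u-max v-max
  deg≥1ᴴ : ∀ x → 1 ≤ deg H x
  deg≥1ᴴ x = ℕP.≤-trans (deg≥1 x) (deg-addEdge-mono x)
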